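{- $\mathsf{g}(C_3 \oplus C_9) \ge 13$.
   Context: $C_n$ denotes the cyclic group of order $n$. For a finite abelian group $G$, the Harborth constant $\mathsf{g}(G)$ is the smallest integer $k$ such that every subset of $G$ of cardinality at least $k$ (equivalently every squarefree sequence over $G$ of length at least $k$) contains a subset of cardinality exactly $\exp(G)$ whose elements sum to $0$. -}

module Defs where

open import Data.Nat using (ℕ; _+_; _≤_; _%_; NonZero)
open import Data.Nat.LCM using (lcm)
open import Data.Fin using (Fin; toℕ)
open import Data.Product using (_×_; _,_; ∃-syntax; proj₁; proj₂)
open import Data.List using (List; length; map)
open import Data.Nat.ListAction using (sum)
open import Data.List.Relation.Unary.All using (All)
open import Data.List.Relation.Unary.Unique.Propositional using (Unique)
open import Data.List.Membership.Propositional using (_∈_)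
open import Relation.Binary.PropositionalEquality using (_≡_)

-- The group C_m ⊕ C_n, with elements (a , b) : Fin m × Fin n,
-- addition componentwise modulo m and n.
Elem : ℕ → ℕ → Set
Elem m n = Fin m × Fin n

expG : ℕ → ℕ → ℕ
expG m n = lcm m n

ZeroSum : (m n : ℕ) → .{{_ : NonZero m}} → .{{_ : NonZero n}} → List (Elem m n) → Set
ZeroSum m n xs =
  (sum (map (λ p → toℕ (proj₁ p)) xs) % m ≡ 0)
  × (sum (map (λ p → toℕ (proj₂ p)) xs) % n ≡ 0)

-- k has the Harborth property: every subset S (a duplicate-free list) of
-- cardinality at least k contains a subset T of cardinality exactly exp(G)
-- whose elements sum to 0.
HarborthProp : (m n : ℕ) → .{{_ : NonZero m}} → .{{_ : NonZero n}} → ℕ → Set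
HarborthProp m n k =
  (S : List (Elem m n)) → Unique S → k ≤ length S →
  ∃[ T ] (Unique T × All (_∈ S) T × length T ≡ expG m n × ZeroSum m n T)

-- g(C_m ⊕ C_n) ≥ b  :⇔  every k with the Harborth property satisfies b ≤ k
-- (g is the smallest such k).
HarborthGeq : (m n : ℕ) → .{{_ : NonZero m}} → .{{_ : NonZero n}} → ℕ → Set
HarborthGeq m n b = (k : ℕ) → HarborthProp m n k → b ≤ k

module Submission where

-- It suffices to exhibit a 12-element subset S of C₃ ⊕ C₉ none of whose
-- 9-element subsets (9 = exp(C₃ ⊕ C₉)) sums to zero: then no k ≤ 12 has
-- the Harborth property, so every k that does is at least 13.  We take
--   S = {0, 1} × {0, 1, 3, 4, 6, 7}.
-- (By hand: a 9-subset is zero-sum iff its 3-element complement sums to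
-- (0, 6); this forces equal first coordinates and three distinct values
-- from {0, 1, 3, 4, 6, 7} summing to 6 or 15 — impossible.)

open import Defs
open import Data.Nat using (ℕ; zero; suc; _%_; _≤?_; NonZero)
open import Data.Nat.Properties using (≰⇒>) renaming (_≟_ to _≟ℕ_)
open import Data.Fin using () renaming (_≟_ to _≟F_)
open import Data.Fin.Patterns using (0F; 1F; 3F; 4F; 6F; 7F)
open import Data.Product using (_×_; _,_; ∃-syntax; proj₂)
open import Data.Product.Properties using (≡-dec)
open import Data.List using (List; []; _∷_; _++_; length; map; filter)
open import Data.Nat.ListAction using (sum)
open import Data.Nat.ListAction.Properties using (sum-↭)
open import Data.List.Relation.Unary.All using (All; all?) renaming (lookup to lookupAll)
open import Data.List.Relation.Unary.Any using (here)
open import Data.List.Relation.Unary.AllPairs using (allPairs?)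
open import Data.List.Relation.Unary.Unique.Propositional using (Unique)
import Data.List.Relation.Unary.Unique.Propositional.Properties as Unique
open import Data.List.Membership.Propositional using (_∈_)
open import Data.List.Membership.Propositional.Properties using (∈-filter⁺; ∈-filter⁻; ∈-++⁺ˡ; ∈-++⁺ʳ; ∈-map⁺)
open import Data.List.Membership.Propositional.Properties.WithK using (unique∧set⇒bag)
open import Data.List.Membership.DecPropositional using () renaming (_∈?_ to member?)
open import Data.List.Relation.Binary.Sublist.Propositional using (_⊆_; []; _∷_; _∷ʳ_)
open import Data.List.Relation.Binary.Sublist.Propositional.Properties using (filter-⊆)
open import Data.List.Relation.Binary.Permutation.Propositional using (_↭_)
open import Data.List.Relation.Binary.Permutation.Propositional.Properties using (↭-length) renaming (map⁺ to ↭-map⁺)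
open import Data.List.Relation.Binary.BagAndSetEquality using (∼bag⇒↭)
open import Function.Bundles using (_⇔_; mk⇔)
open import Relation.Binary.Definitions using (DecidableEquality)
open import Relation.Binary.PropositionalEquality using (_≡_; refl; sym; trans; subst)
open import Relation.Nullary using (Dec; ¬_; ¬?; yes; no)
open import Relation.Nullary.Decidable using (toWitness; _×-dec_)
open import Data.Unit using (tt)
open import Data.Empty using (⊥-elim)

module _ {A : Set} where

  choose : ℕ → List A → List (List A)
  choose zero    xs       = [] ∷ []
  choose (suc k) []       = []
  choose (suc k) (x ∷ xs) = map (x ∷_) (choose k xs) ++ choose (suc k) xs

  choose-complete : ∀ {T S} → T ⊆ S → T ∈ choose (length T) S
  choose-complete {[]}    _            = here refl
  choose-complete {_ ∷ _} (y ∷ʳ T⊆S)   = ∈-++⁺ʳ _ (choose-complete T⊆S)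
  choose-complete {_ ∷ _} (refl ∷ T⊆S) = ∈-++⁺ˡ (∈-map⁺ _ (choose-complete T⊆S))

module _ {A : Set} (_≟_ : DecidableEquality A) where

  -- A duplicate-free list T drawn from a duplicate-free list S is a
  -- permutation of a sublist of S, namely of S filtered by membership in
  -- T: both lists are duplicate-free with the same elements.
  subset⇒sublist : ∀ {S T} → Unique S → Unique T → All (_∈ S) T →
                   ∃[ T′ ] (T′ ⊆ S × T ↭ T′)
  subset⇒sublist {S} {T} uS uT T⊆S =
    filter inT? S , filter-⊆ inT? S ,
    ∼bag⇒↭ (unique∧set⇒bag uT (Unique.filter⁺ inT? uS) sameElements)
    where
    inT? : (x : A) → Dec (x ∈ T)
    inT? x = member? _≟_ x T
    sameElements : ∀ {x} → (x ∈ T) ⇔ (x ∈ filter inT? S)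
    sameElements = mk⇔ (λ x∈T → ∈-filter⁺ inT? (lookupAll T⊆S x∈T) x∈T)
                       (λ x∈F → proj₂ (∈-filter⁻ inT? {xs = S} x∈F))

module _ {m n : ℕ} .{{_ : NonZero m}} .{{_ : NonZero n}} where

  _≟E_ : DecidableEquality (Elem m n)
  _≟E_ = ≡-dec _≟F_ _≟F_

  zeroSum? : (T : List (Elem m n)) → Dec (ZeroSum m n T)
  zeroSum? T = (_ ≟ℕ 0) ×-dec (_ ≟ℕ 0)

  zeroSum-↭ : ∀ {T T′} → T ↭ T′ → ZeroSum m n T → ZeroSum m n T′
  zeroSum-↭ T↭T′ (zero₁ , zero₂) =
    subst (λ s → s % m ≡ 0) (sum-↭ (↭-map⁺ _ T↭T′)) zero₁ ,
    subst (λ s → s % n ≡ 0) (sum-↭ (↭-map⁺ _ T↭T′)) zero₂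

  -- The general lower bound: a set S without zero-sum subsets of
  -- cardinality exp(G) shows g(G) ≥ |S| + 1.  A k ≤ |S| with the Harborth
  -- property would give such a subset T of S; rearranged as a sublist of
  -- S it is listed by `choose`, contradicting the hypothesis.
  harborth-lower-bound : (S : List (Elem m n)) → Unique S →
    All (λ T → ¬ ZeroSum m n T) (choose (expG m n) S) →
    HarborthGeq m n (suc (length S))
  harborth-lower-bound S uS noZeroSum k harborth with k ≤? length S
  ... | no  k≰|S| = ≰⇒> k≰|S|
  ... | yes k≤|S| with harborth S uS k≤|S|
  ...   | T , uT , T⊆S , |T|≡exp , zeroSumT with subset⇒sublist _≟E_ uS uT T⊆S
  ...     | T′ , T′⊆S , T↭T′ =
    ⊥-elim (lookupAll noZeroSum T′∈choose (zeroSum-↭ T↭T′ zeroSumT))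
    where
    T′∈choose : T′ ∈ choose (expG m n) S
    T′∈choose = subst (λ l → T′ ∈ choose l S)
                      (trans (sym (↭-length T↭T′)) |T|≡exp) (choose-complete T′⊆S)

witness : List (Elem 3 9)
witness = (0F , 0F) ∷ (0F , 1F) ∷ (0F , 3F) ∷ (0F , 4F) ∷ (0F , 6F) ∷ (0F , 7F) ∷
          (1F , 0F) ∷ (1F , 1F) ∷ (1F , 3F) ∷ (1F , 4F) ∷ (1F , 6F) ∷ (1F , 7F) ∷ []

witness-unique : Unique witness
witness-unique = toWitness {a? = allPairs? (λ x y → ¬? (x ≟E y)) witness} tt

witness-zeroSumFree : All (λ T → ¬ ZeroSum 3 9 T) (choose 9 witness)
witness-zeroSumFree = toWitness {a? = all? (λ T → ¬? (zeroSum? T)) (choose 9 witness)} tt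

lemma3p5 : HarborthGeq 3 9 13
lemma3p5 = harborth-lower-bound witness witness-unique witness-zeroSumFree
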